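{- Let $G$ be a graph with $n$ vertices and minimum degree $\delta(G)>\frac45 n$. Then for every $e\in E(G)$, $$\sum_{T\in\mathcal K_4(G):\, e\in E(T)}W_G(T)=1.$$
   Context: For $v\in V(G)$, $N(v)$ is its neighborhood; for $S\subseteq V(G)$ nonempty, $N(S)=\bigcap_{v\in S}N(v)$, also written $N(v_1,\dots,v_r)$. An ordered $l$-clique is an $l$-tuple $(v_1,\dots,v_l)$ of distinct vertices forming a clique; $\mathcal{OK}_l(G)$ is the set of ordered $l$-cliques. For $r\in\{2,3,4,5\}$ and $(v_1,\dots,v_r)\in\mathcal{OK}_r(G)$, $W(v_1,\dots,v_r)=\prod_{i=2}^r\frac{1}{|N(v_1,\dots,v_i)|}$. $\mathcal K_4(G)$ is the set of copies of $K_4$ in $G$. For a copy $K$ of $K_6$ in $G$ and an edge $e$ of $K$, the edge-gadget $\psi_{K,e}:\mathcal K_4(G)\to\mathbb R$ is: $\frac12$ if $T\subseteq K$ and $e\cap V(T)=\emptyset$; $-\frac16$ if $T\subseteq K$ and $|e\cap V(T)|=1$; $\frac16$ if $T\subseteq K$ and $e\in E(T)$; $0$ otherwise. Define $W_G:\mathcal K_4(G)\to\mathbb R$ by $$W_G(T)=\frac12\sum_{(v_1,\dots,v_6)\in\mathcal{OK}_6(G)}W(v_1,\dots,v_5)\,\psi_{G[\{v_1,\dots,v_6\}],\{v_1,v_2\}}(T).$$ -}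

module Defs where

open import Data.Bool using (Bool; true; false; if_then_else_; _∧_)
open import Data.Nat as ℕ using (ℕ; zero; suc)
open import Data.Fin using (Fin)
open import Data.Fin.Properties using (_≟_)
open import Data.Fin using (_<?_)
open import Data.List using (List; []; _∷_; map; allFin; length; filterᵇ)
open import Data.Bool.ListAction using (all; any)
open import Data.Integer using (+_; -[1+_])
open import Data.Rational using (ℚ; _+_; _*_; _/_; 0ℚ; 1ℚ)
open import Relation.Nullary.Decidable using (⌊_⌋)
open import Relation.Binary.PropositionalEquality using (_≡_)

record Graph (n : ℕ) : Set where
  field
    adj    : Fin n → Fin n → Bool
    sym    : ∀ u v → adj u v ≡ adj v u
    irrefl : ∀ v → adj v v ≡ false
open Graph public

sumℚ : List ℚ → ℚ
sumℚ []       = 0ℚ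
sumℚ (x ∷ xs) = x + sumℚ xs

Σv : ∀ {n} → (Fin n → ℚ) → ℚ
Σv {n} f = sumℚ (map f (allFin n))

deg : ∀ {n} → Graph n → Fin n → ℕ
deg {n} G v = length (filterᵇ (adj G v) (allFin n))

minDegGT45 : ∀ {n} → Graph n → Set
minDegGT45 {n} G = ∀ v → 4 ℕ.* n ℕ.< 5 ℕ.* deg G v

-- ordered clique: entries pairwise adjacent (irreflexivity forces distinctness)
isClique : ∀ {n} → Graph n → List (Fin n) → Bool
isClique G []       = true
isClique G (v ∷ vs) = all (adj G v) vs ∧ isClique G vs

commonNbr : ∀ {n} → Graph n → List (Fin n) → ℕ
commonNbr {n} G S =
  length (filterᵇ (λ w → all (λ s → adj G s w) S) (allFin n))

-- 1/k as a rational (k = 0 never occurs under the theorem's hypotheses; set to 0)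
inv : ℕ → ℚ
inv zero    = 0ℚ
inv (suc k) = + 1 / suc k

W5 : ∀ {n} → Graph n → Fin n → Fin n → Fin n → Fin n → Fin n → ℚ
W5 G v1 v2 v3 v4 v5 =
  inv (commonNbr G (v1 ∷ v2 ∷ []))
  * (inv (commonNbr G (v1 ∷ v2 ∷ v3 ∷ []))
  * (inv (commonNbr G (v1 ∷ v2 ∷ v3 ∷ v4 ∷ []))
  * inv (commonNbr G (v1 ∷ v2 ∷ v3 ∷ v4 ∷ v5 ∷ []))))

elem : ∀ {n} → Fin n → List (Fin n) → Bool
elem v xs = any (λ w → ⌊ v ≟ w ⌋) xs

countIn : ∀ {n} → List (Fin n) → List (Fin n) → ℕ
countIn xs ys = length (filterᵇ (λ x → elem x ys) xs)

-- A copy of K4 is represented by its vertex list T (4 distinct clique vertices).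
-- Edge gadget ψ_{K,e}(T) with K given by its vertex list and e = {a , b} an edge of K.
ψ : ∀ {n} → List (Fin n) → Fin n → Fin n → List (Fin n) → ℚ
ψ K a b T =
  if all (λ t → elem t K) T
  then gadget (countIn (a ∷ b ∷ []) T)
  else 0ℚ
  where
  gadget : ℕ → ℚ
  gadget 0 = + 1 / 2
  gadget 1 = -[1+ 0 ] / 6
  gadget 2 = + 1 / 6   -- both ends of e in T, so e ∈ E(T) since T is a clique
  gadget _ = 0ℚ

WG : ∀ {n} → Graph n → List (Fin n) → ℚ
WG G T = (+ 1 / 2) *
  Σv λ v1 → Σv λ v2 → Σv λ v3 → Σv λ v4 → Σv λ v5 → Σv λ v6 →
    if isClique G (v1 ∷ v2 ∷ v3 ∷ v4 ∷ v5 ∷ v6 ∷ [])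
    then W5 G v1 v2 v3 v4 v5 * ψ (v1 ∷ v2 ∷ v3 ∷ v4 ∷ v5 ∷ v6 ∷ []) v1 v2 T
    else 0ℚ

-- Σ_{T ∈ K4(G), e ∈ E(T)} W_G(T) for e = {u , v}; each copy of K4 is enumerated
-- once as its strictly increasing vertex list a < b < c < d.
sumK4Containing : ∀ {n} → Graph n → Fin n → Fin n → ℚ
sumK4Containing G u v =
  Σv λ a → Σv λ b → Σv λ c → Σv λ d →
    if ⌊ a <? b ⌋ ∧ ⌊ b <? c ⌋ ∧ ⌊ c <? d ⌋
       ∧ isClique G (a ∷ b ∷ c ∷ d ∷ [])
       ∧ elem u (a ∷ b ∷ c ∷ d ∷ []) ∧ elem v (a ∷ b ∷ c ∷ d ∷ [])
    then WG G (a ∷ b ∷ c ∷ d ∷ [])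
    else 0ℚ

-- Exchanging the order of summation, the left-hand side becomes
--   ½ Σ_{(v₁,…,v₆) ∈ OK₆(G)} W(v₁,…,v₅) Σ_{T ∈ K₄(K), e ∈ T} ψ_{K,{v₁,v₂}}(T)
-- with K = {v₁,…,v₆}.
-- The inner sum is 1 if e = {v₁,v₂} and 0 otherwise (the defining property of an edge-gadget);
-- after transporting K onto the complete graph on Fin 6 along its increasing enumeration, this
-- is a finite computation. What remains is ½ (Ω(u,v) + Ω(v,u)), where Ω(x,y) sums the weights
-- of the ordered 6-cliques starting with (x,y). It telescopes to 1: summing W over the last
-- vertex cancels one factor 1/|N(v₁,…,vᵢ)|, because any i ≤ 5 vertices of a graph with
-- δ(G) > 4n/5 have a common neighbour.
module Submission where

open import Defs hiding (sym)
open import Algebra.Bundles using (CommutativeMonoid; Ring)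
import Data.Rational.Properties as ℚ
open import Algebra.Properties.Semiring.Sum (Ring.semiring ℚ.+-*-ring)
  using (sum; sum-cong-≗; sum-remove; ∑-comm; ∑-distrib-+; *-distribˡ-sum; sum-replicate-zero)
open import Algebra.Properties.Semiring.Mult (Ring.semiring ℚ.+-*-ring) using (_×_; ×-comm-*; ×-assoc-*)
import Data.Bool.Properties as Bool
open import Algebra.Properties.CommutativeSemigroup
  (CommutativeMonoid.commutativeSemigroup Bool.∧-commutativeMonoid) using (interchange)
open import Data.Bool using (Bool; true; false; T; if_then_else_; _∧_; _∨_; not)
open import Data.Bool.ListAction using (all; any)
open import Data.Empty using (⊥-elim)
open import Data.Fin using (Fin; zero; suc; _<_; _<?_; cast; punchIn)
import Data.Fin.Properties as Fin
open import Data.Fin.Properties using (_≟_; all?)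
import Data.Integer as ℤ
open import Data.Integer.Tactic.RingSolver as ℤ-Solver using ()
open import Data.List using (List; []; _∷_; _++_; map; allFin; tabulate; filterᵇ; length; lookup)
open import Data.List.Properties using (map-tabulate; map-cong; length-tabulate)
open import Data.List.Membership.Propositional using (_∈_)
open import Data.List.Membership.Propositional.Properties using (∈-lookup; ∈-allFin)
open import Data.List.Relation.Binary.Permutation.Propositional using (↭-sym; ↭⇒↭ₛ)
open import Data.List.Relation.Binary.Permutation.Propositional.Properties using (↭-length; ∈-resp-↭)
import Data.List.Relation.Binary.Permutation.Setoid.Properties as PermutationSetoid
open import Data.List.Relation.Unary.All as All using (All; []; _∷_)
open import Data.List.Relation.Unary.AllPairs as AllPairs using (AllPairs; []; _∷_)
open import Data.List.Relation.Unary.Any using (here; there; index)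
open import Data.List.Relation.Unary.Any.Properties using (lookup-index)
open import Data.List.Relation.Unary.Linked.Properties using (Linked⇒AllPairs)
open import Data.Nat as ℕ using (ℕ; z≤n; s≤s)
import Data.Nat.Properties as ℕ
open import Data.Nat.Coprimality using (1-coprimeTo) renaming (sym to coprime-sym)
open import Data.Nat.Tactic.RingSolver as ℕ-Solver using ()
open import Data.Product using (∃; _,_)
open import Data.Rational using (ℚ; mkℚ; 0ℚ; 1ℚ; _+_; _*_; _/_; 1/_)
import Data.Rational.Unnormalised as ℚᵘ
import Data.Rational.Unnormalised.Properties as ℚᵘ
open import Function using (_∘_; id)
open import Relation.Binary.Definitions using (Symmetric; tri<; tri≈; tri>)
open import Relation.Binary.PropositionalEquality
open import Relation.Nullary using (¬_; yes; no)
open import Relation.Nullary.Decidable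
  using (Dec; ⌊_⌋; isYes≗does; dec-true; dec-false; toWitness; _→-dec_; ¬?)

private variable
  n m : ℕ
  A B : Set

-- Finite sums

when : Bool → ℚ → ℚ
when b x = if b then x else 0ℚ

when-≡0 : {b : Bool} {x : ℚ} → x ≡ 0ℚ → when b x ≡ 0ℚ
when-≡0 {true}  x≡0 = x≡0
when-≡0 {false} _   = refl

when-∧ : (p q : Bool) (x : ℚ) → when (p ∧ q) x ≡ when p (when q x)
when-∧ true  q x = refl
when-∧ false q x = refl

when-* : (b : Bool) (c x : ℚ) → when b (c * x) ≡ c * when b x
when-* true  c x = refl
when-* false c x = sym (ℚ.*-zeroʳ c)

ΣL : List A → (A → ℚ) → ℚ
ΣL xs f = sumℚ (map f xs)

ΣL-cong : (xs : List A) {f g : A → ℚ} → (∀ x → f x ≡ g x) → ΣL xs f ≡ ΣL xs g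
ΣL-cong xs f≗g = cong sumℚ (map-cong f≗g xs)

ΣL-filterᵇ : (xs : List A) (p : A → Bool) (S : Bool → A → ℚ) →
  (∀ x → S false x ≡ 0ℚ) → ΣL xs (λ x → S (p x) x) ≡ ΣL (filterᵇ p xs) (S true)
ΣL-filterᵇ []       p S S≡0 = refl
ΣL-filterᵇ (x ∷ xs) p S S≡0 with p x
... | true  = cong (S true x +_) (ΣL-filterᵇ xs p S S≡0)
... | false = trans (cong₂ _+_ (S≡0 x) (ΣL-filterᵇ xs p S S≡0)) (ℚ.+-identityˡ _)

ΣL-const : (xs : List A) (c : ℚ) → ΣL xs (λ _ → c) ≡ length xs × c
ΣL-const []       c = refl
ΣL-const (x ∷ xs) c = cong (c +_) (ΣL-const xs c)

sumℚ-tabulate : (f : Fin n → ℚ) → sumℚ (tabulate f) ≡ sum f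
sumℚ-tabulate {ℕ.zero}  f = refl
sumℚ-tabulate {ℕ.suc n} f = cong (f zero +_) (sumℚ-tabulate (f ∘ suc))

Σv≡sum : (f : Fin n → ℚ) → Σv f ≡ sum f
Σv≡sum f = trans (cong sumℚ (map-tabulate id f)) (sumℚ-tabulate f)

Σv-cong : {f g : Fin n → ℚ} → (∀ x → f x ≡ g x) → Σv f ≡ Σv g
Σv-cong {f = f} {g} f≗g = begin
  Σv f   ≡⟨ Σv≡sum f ⟩
  sum f  ≡⟨ sum-cong-≗ f≗g ⟩
  sum g  ≡⟨ Σv≡sum g ⟨
  Σv g   ∎
  where open ≡-Reasoning

Σv-zero : {f : Fin n → ℚ} → (∀ x → f x ≡ 0ℚ) → Σv f ≡ 0ℚ
Σv-zero {n} f≗0 = trans (Σv-cong f≗0) (trans (Σv≡sum {n} (λ _ → 0ℚ)) (sum-replicate-zero n))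

Σv-comm : (f : Fin n → Fin m → ℚ) → Σv (λ x → Σv (f x)) ≡ Σv (λ y → Σv (λ x → f x y))
Σv-comm f = begin
  Σv (λ x → Σv (f x))            ≡⟨ Σv-cong (λ x → Σv≡sum (f x)) ⟩
  Σv (λ x → sum (f x))           ≡⟨ Σv≡sum (λ x → sum (f x)) ⟩
  sum (λ x → sum (f x))          ≡⟨ ∑-comm f ⟩
  sum (λ y → sum (λ x → f x y))  ≡⟨ Σv≡sum (λ y → sum (λ x → f x y)) ⟨
  Σv (λ y → sum (λ x → f x y))   ≡⟨ Σv-cong (λ y → Σv≡sum (λ x → f x y)) ⟨
  Σv (λ y → Σv (λ x → f x y))    ∎
  where open ≡-Reasoning

Σv-distrib-+ : (f g : Fin n → ℚ) → Σv (λ x → f x + g x) ≡ Σv f + Σv g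
Σv-distrib-+ f g = begin
  Σv (λ x → f x + g x)   ≡⟨ Σv≡sum (λ x → f x + g x) ⟩
  sum (λ x → f x + g x)  ≡⟨ ∑-distrib-+ f g ⟩
  sum f + sum g          ≡⟨ cong₂ _+_ (Σv≡sum f) (Σv≡sum g) ⟨
  Σv f + Σv g            ∎
  where open ≡-Reasoning

*-distribˡ-Σv : (c : ℚ) (f : Fin n → ℚ) → c * Σv f ≡ Σv (λ x → c * f x)
*-distribˡ-Σv c f = begin
  c * Σv f             ≡⟨ cong (c *_) (Σv≡sum f) ⟩
  c * sum f            ≡⟨ *-distribˡ-sum c f ⟩
  sum (λ x → c * f x)  ≡⟨ Σv≡sum (λ x → c * f x) ⟨
  Σv (λ x → c * f x)   ∎
  where open ≡-Reasoning

Σv-when : (b : Bool) (f : Fin n → ℚ) → Σv (λ x → when b (f x)) ≡ when b (Σv f)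
Σv-when true      f = refl
Σv-when {n} false f = Σv-zero {n} (λ _ → refl)

Σv-δ : (f : Fin n → ℚ) (p : Fin n) → (∀ x → x ≢ p → f x ≡ 0ℚ) → Σv f ≡ f p
Σv-δ {ℕ.suc n} f p f≡0 = begin
  Σv f                       ≡⟨ Σv≡sum f ⟩
  sum f                      ≡⟨ sum-remove f ⟩
  f p + sum (f ∘ punchIn p)  ≡⟨ cong (f p +_) (trans (sym (Σv≡sum (f ∘ punchIn p)))
                                                      (Σv-zero (λ x → f≡0 _ (Fin.punchInᵢ≢i p x)))) ⟩
  f p + 0ℚ                   ≡⟨ ℚ.+-identityʳ (f p) ⟩
  f p                        ∎
  where open ≡-Reasoning

⌊⌋-yes : (a? : Dec A) → A → ⌊ a? ⌋ ≡ true
⌊⌋-yes a? a = trans (isYes≗does a?) (dec-true a? a)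

⌊⌋-no : (a? : Dec A) → ¬ A → ⌊ a? ⌋ ≡ false
⌊⌋-no a? ¬a = trans (isYes≗does a?) (dec-false a? ¬a)

Σv-reindex : {w : Fin m → Fin n} → (∀ {i j} → w i ≡ w j → i ≡ j) →
  (f : Fin n → ℚ) → (∀ x → (∀ i → x ≢ w i) → f x ≡ 0ℚ) → Σv f ≡ Σv (f ∘ w)
Σv-reindex {m = m} {w = w} injective f outside≡0 = begin
    Σv f
  ≡⟨ Σv-cong split ⟩
    Σv (λ x → Σv λ i → when ⌊ x ≟ w i ⌋ (f x))
  ≡⟨ Σv-comm (λ x i → when ⌊ x ≟ w i ⌋ (f x)) ⟩
    Σv (λ i → Σv λ x → when ⌊ x ≟ w i ⌋ (f x))
  ≡⟨ Σv-cong (λ i → Σv-δ _ (w i) (λ x x≢wi → cong (λ b → when b (f x)) (⌊⌋-no (x ≟ w i) x≢wi))) ⟩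
    Σv (λ i → when ⌊ w i ≟ w i ⌋ (f (w i)))
  ≡⟨ Σv-cong (λ i → cong (λ b → when b (f (w i))) (⌊⌋-yes (w i ≟ w i) refl)) ⟩
    Σv (f ∘ w)
  ∎
  where
  open ≡-Reasoning
  split : ∀ x → f x ≡ Σv λ i → when ⌊ x ≟ w i ⌋ (f x)
  split x with Fin.any? (λ i → x ≟ w i)
  ... | yes (i , refl) = sym (trans
          (Σv-δ _ i (λ j j≢i → cong (λ b → when b (f (w i))) (⌊⌋-no (w i ≟ w j) (j≢i ∘ sym ∘ injective))))
          (cong (λ b → when b (f (w i))) (⌊⌋-yes (w i ≟ w i) refl)))
  ... | no  x∉w = trans f≡0 (sym (Σv-zero {m} λ i → when-≡0 f≡0))
    where f≡0 = outside≡0 x (λ i x≡wi → x∉w (i , x≡wi))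

Σv⁴ : (Fin n → Fin n → Fin n → Fin n → ℚ) → ℚ
Σv⁴ F = Σv λ a → Σv λ b → Σv λ c → Σv λ d → F a b c d

Σv⁶ : (Fin n → Fin n → Fin n → Fin n → Fin n → Fin n → ℚ) → ℚ
Σv⁶ F = Σv λ v₁ → Σv λ v₂ → Σv⁴ (F v₁ v₂)

Σv⁴-cong : {F F′ : Fin n → Fin n → Fin n → Fin n → ℚ} →
  (∀ a b c d → F a b c d ≡ F′ a b c d) → Σv⁴ F ≡ Σv⁴ F′
Σv⁴-cong F≗F′ = Σv-cong λ a → Σv-cong λ b → Σv-cong λ c → Σv-cong λ d → F≗F′ a b c d

Σv⁶-cong : {F F′ : Fin n → Fin n → Fin n → Fin n → Fin n → Fin n → ℚ} →
  (∀ v₁ v₂ v₃ v₄ v₅ v₆ → F v₁ v₂ v₃ v₄ v₅ v₆ ≡ F′ v₁ v₂ v₃ v₄ v₅ v₆) → Σv⁶ F ≡ Σv⁶ F′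
Σv⁶-cong F≗F′ = Σv-cong λ v₁ → Σv-cong λ v₂ → Σv⁴-cong (F≗F′ v₁ v₂)

Σv⁴-zero : {F : Fin n → Fin n → Fin n → Fin n → ℚ} → (∀ a b c d → F a b c d ≡ 0ℚ) → Σv⁴ F ≡ 0ℚ
Σv⁴-zero {n} F≡0 = Σv-zero {n} λ a → Σv-zero {n} λ b → Σv-zero {n} λ c → Σv-zero {n} λ d → F≡0 a b c d

*-distribˡ-Σv⁴ : (c : ℚ) (F : Fin n → Fin n → Fin n → Fin n → ℚ) →
  c * Σv⁴ F ≡ Σv⁴ (λ a b c′ d → c * F a b c′ d)
*-distribˡ-Σv⁴ c F =
  trans (*-distribˡ-Σv c (λ a → Σv λ b → Σv λ c′ → Σv λ d → F a b c′ d)) (Σv-cong λ a →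
  trans (*-distribˡ-Σv c (λ b → Σv λ c′ → Σv λ d → F a b c′ d)) (Σv-cong λ b →
  trans (*-distribˡ-Σv c (λ c′ → Σv λ d → F a b c′ d)) (Σv-cong λ c′ → *-distribˡ-Σv c (F a b c′))))

Σv⁴-Σv-comm : (H : Fin n → Fin n → Fin n → Fin n → Fin n → ℚ) →
  Σv⁴ (λ a b c d → Σv λ x → H x a b c d) ≡ Σv (λ x → Σv⁴ (H x))
Σv⁴-Σv-comm H =
  trans (Σv-cong λ a → Σv-cong λ b → Σv-cong λ c → Σv-comm (λ d x → H x a b c d))
  (trans (Σv-cong λ a → Σv-cong λ b → Σv-comm (λ c x → Σv λ d → H x a b c d))
  (trans (Σv-cong λ a → Σv-comm (λ b x → Σv λ c → Σv λ d → H x a b c d))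
         (Σv-comm (λ a x → Σv λ b → Σv λ c → Σv λ d → H x a b c d))))

Σv⁴-reindex : {w : Fin m → Fin n} → (∀ {i j} → w i ≡ w j → i ≡ j) →
  (F : Fin n → Fin n → Fin n → Fin n → ℚ) →
  (∀ a b c d {x} → x ∈ a ∷ b ∷ c ∷ d ∷ [] → (∀ i → x ≢ w i) → F a b c d ≡ 0ℚ) →
  Σv⁴ F ≡ Σv⁴ (λ i j k l → F (w i) (w j) (w k) (w l))
Σv⁴-reindex {n = n} {w = w} injective F vanish =
  trans (Σv-reindex injective (λ a → Σv λ b → Σv λ c → Σv λ d → F a b c d)
          (λ a out → Σv-zero {n} λ b → Σv-zero {n} λ c → Σv-zero {n} λ d → vanish a b c d (here refl) out))
  (Σv-cong λ i → trans (Σv-reindex injective (λ b → Σv λ c → Σv λ d → F (w i) b c d)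
          (λ b out → Σv-zero {n} λ c → Σv-zero {n} λ d → vanish (w i) b c d (there (here refl)) out))
  (Σv-cong λ j → trans (Σv-reindex injective (λ c → Σv λ d → F (w i) (w j) c d)
          (λ c out → Σv-zero {n} λ d → vanish (w i) (w j) c d (there (there (here refl))) out))
  (Σv-cong λ k → Σv-reindex injective (λ d → F (w i) (w j) (w k) d)
          (λ d out → vanish (w i) (w j) (w k) d (there (there (there (here refl)))) out))))

above : Fin n → List (Fin n)
above a = filterᵇ (λ b → ⌊ a <? b ⌋) (allFin _)

Σ-increasing⁴ : (Fin n → Fin n → Fin n → Fin n → ℚ) → ℚ
Σ-increasing⁴ F = Σv λ a → ΣL (above a) λ b → ΣL (above b) λ c → ΣL (above c) λ d → F a b c d

Σv⁴-when-ordered : (X : Fin n → Fin n → Fin n → Fin n → Bool) (Y : Fin n → Fin n → Fin n → Fin n → ℚ) →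
  Σv⁴ (λ a b c d → when (⌊ a <? b ⌋ ∧ ⌊ b <? c ⌋ ∧ ⌊ c <? d ⌋ ∧ X a b c d) (Y a b c d))
  ≡ Σ-increasing⁴ (λ a b c d → when (X a b c d) (Y a b c d))
Σv⁴-when-ordered {n} X Y = Σv-cong λ a →
  trans (ΣL-filterᵇ (allFin n) (λ b → ⌊ a <? b ⌋)
          (λ q b → Σv λ c → Σv λ d → when (q ∧ ⌊ b <? c ⌋ ∧ ⌊ c <? d ⌋ ∧ X a b c d) (Y a b c d))
          (λ b → Σv-zero {n} λ c → Σv-zero {n} λ d → refl))
  (ΣL-cong (above a) λ b →
  trans (ΣL-filterᵇ (allFin n) (λ c → ⌊ b <? c ⌋)
          (λ q c → Σv λ d → when (q ∧ ⌊ c <? d ⌋ ∧ X a b c d) (Y a b c d))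
          (λ c → Σv-zero {n} λ d → refl))
  (ΣL-cong (above b) λ c →
  ΣL-filterᵇ (allFin n) (λ d → ⌊ c <? d ⌋) (λ q d → when (q ∧ X a b c d) (Y a b c d)) (λ d → refl)))

-- Cliques and their increasing enumerations

∈⇒elem : {x : Fin n} {xs : List (Fin n)} → x ∈ xs → elem x xs ≡ true
∈⇒elem {x = x} {_ ∷ xs} (here refl)  = cong (_∨ elem x xs) (⌊⌋-yes (x ≟ x) refl)
∈⇒elem {x = x} {y ∷ _}  (there x∈xs) = trans (cong (⌊ x ≟ y ⌋ ∨_) (∈⇒elem x∈xs)) (Bool.∨-zeroʳ _)

elem⇒∈ : {x : Fin n} {xs : List (Fin n)} → elem x xs ≡ true → x ∈ xs
elem⇒∈ {x = x} {y ∷ ys} x∈xs with x ≟ y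
... | yes x≡y = here x≡y
... | no  _   = there (elem⇒∈ x∈xs)

absent⇒≢ : {K : List (Fin n)} {u x : Fin n} → elem u K ≡ false → x ∈ K → x ≢ u
absent⇒≢ u∉K x∈K refl with () ← trans (sym u∉K) (∈⇒elem x∈K)

all⇒All : {p : A → Bool} {xs : List A} → all p xs ≡ true → All (λ x → p x ≡ true) xs
all⇒All {xs = []}         _ = []
all⇒All {p = p} {x ∷ xs} h with p x in px
... | true = px ∷ all⇒All h

all-false : {p : A → Bool} {x : A} {xs : List A} → x ∈ xs → p x ≡ false → all p xs ≡ false
all-false {xs = _ ∷ _}     (here refl) px≡false rewrite px≡false = refl
all-false {p = p} {xs = y ∷ _} (there x∈xs) px≡false =
  trans (cong (p y ∧_) (all-false x∈xs px≡false)) (Bool.∧-zeroʳ (p y))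

all-snoc : (p : A → Bool) (xs : List A) (z : A) → all p (xs ++ z ∷ []) ≡ all p xs ∧ p z
all-snoc p []       z = Bool.∧-identityʳ (p z)
all-snoc p (x ∷ xs) z = trans (cong (p x ∧_) (all-snoc p xs z)) (sym (Bool.∧-assoc (p x) _ _))

module _ {w : A → B} where

  all-map : {p : B → Bool} {q : A → Bool} → (∀ x → p (w x) ≡ q x) → ∀ xs → all p (map w xs) ≡ all q xs
  all-map p∘w≗q []       = refl
  all-map p∘w≗q (x ∷ xs) = cong₂ _∧_ (p∘w≗q x) (all-map p∘w≗q xs)

  any-map : {p : B → Bool} {q : A → Bool} → (∀ x → p (w x) ≡ q x) → ∀ xs → any p (map w xs) ≡ any q xs
  any-map p∘w≗q []       = refl
  any-map p∘w≗q (x ∷ xs) = cong₂ _∨_ (p∘w≗q x) (any-map p∘w≗q xs)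

isClique⇒AllPairs : (G : Graph n) {xs : List (Fin n)} → isClique G xs ≡ true →
  AllPairs (λ x y → adj G x y ≡ true) xs
isClique⇒AllPairs G {[]}     _ = []
isClique⇒AllPairs G {x ∷ xs} h with all (adj G x) xs in px
... | true = all⇒All px ∷ isClique⇒AllPairs G h

isClique-snoc : (G : Graph n) (S : List (Fin n)) (z : Fin n) →
  isClique G (S ++ z ∷ []) ≡ isClique G S ∧ all (λ s → adj G s z) S
isClique-snoc G []       z = refl
isClique-snoc G (x ∷ xs) z = trans (cong₂ _∧_ (all-snoc (adj G x) xs z) (isClique-snoc G xs z))
  (interchange (all (adj G x) xs) (adj G x z) (isClique G xs) (all (λ s → adj G s z) xs))

adjacent⇒≢ : (G : Graph n) {x y : Fin n} → adj G x y ≡ true → x ≢ y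
adjacent⇒≢ G {x} h refl with () ← trans (sym h) (irrefl G x)

AllPairs-∈ : {R : A → A → Set} {xs : List A} {x y : A} →
  Symmetric R → AllPairs R xs → x ∈ xs → y ∈ xs → x ≢ y → R x y
AllPairs-∈ R-sym (Rx ∷ _)   (here refl) (here refl) x≢y = ⊥-elim (x≢y refl)
AllPairs-∈ R-sym (Rx ∷ _)   (here refl) (there y∈)  _   = All.lookup Rx y∈
AllPairs-∈ R-sym (Rx ∷ _)   (there x∈)  (here refl) _   = R-sym (All.lookup Rx x∈)
AllPairs-∈ R-sym (_ ∷ Rxs) (there x∈)  (there y∈)  x≢y = AllPairs-∈ R-sym Rxs x∈ y∈ x≢y

AllPairs-lookup : {R : A → A → Set} {xs : List A} → AllPairs R xs →
  ∀ {i j} → i < j → R (lookup xs i) (lookup xs j)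
AllPairs-lookup (Rx ∷ _)   {zero}  {suc j} _         = All.lookup Rx (∈-lookup j)
AllPairs-lookup (_ ∷ Rxs) {suc i} {suc j} (s≤s i<j) = AllPairs-lookup Rxs i<j

module StrictlyMonotone {w : Fin m → Fin n} (strict : ∀ {i j} → i < j → w i < w j) where

  injective : ∀ {i j} → w i ≡ w j → i ≡ j
  injective {i} {j} wi≡wj with Fin.<-cmp i j
  ... | tri< i<j _ _ = ⊥-elim (Fin.<⇒≢ (strict i<j) wi≡wj)
  ... | tri≈ _ i≡j _ = i≡j
  ... | tri> _ _ j<i = ⊥-elim (Fin.<⇒≢ (strict j<i) (sym wi≡wj))

  <?-preserved : ∀ i j → ⌊ w i <? w j ⌋ ≡ ⌊ i <? j ⌋
  <?-preserved i j with Fin.<-cmp i j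
  ... | tri< i<j _ _   = trans (⌊⌋-yes (w i <? w j) (strict i<j)) (sym (⌊⌋-yes (i <? j) i<j))
  ... | tri≈ _ refl _ =
    trans (⌊⌋-no (w i <? w i) (Fin.<-irrefl refl)) (sym (⌊⌋-no (i <? i) (Fin.<-irrefl refl)))
  ... | tri> i≮j _ j<i = trans (⌊⌋-no (w i <? w j) (Fin.<-asym (strict j<i))) (sym (⌊⌋-no (i <? j) i≮j))

  ≟-preserved : ∀ i j → ⌊ w i ≟ w j ⌋ ≡ ⌊ i ≟ j ⌋
  ≟-preserved i j with i ≟ j
  ... | yes refl = ⌊⌋-yes (w i ≟ w i) refl
  ... | no  i≢j  = ⌊⌋-no (w i ≟ w j) (i≢j ∘ injective)

record IncreasingEnumeration (K : List (Fin n)) : Set where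
  field
    vertex : Fin (length K) → Fin n
    strict : ∀ {i j} → i < j → vertex i < vertex j
    inside : ∀ i → vertex i ∈ K
    onto   : ∀ {x} → x ∈ K → ∃ λ i → x ≡ vertex i

sortedEnumeration : (K : List (Fin n)) → AllPairs _≢_ K → IncreasingEnumeration K
sortedEnumeration {n} K distinct = record
  { vertex = vertex
  ; strict = λ i<j → AllPairs-lookup increasing (cast-strict i<j)
  ; inside = λ i → ∈-resp-↭ (sort-↭ K) (∈-lookup (cast _ i))
  ; onto   = onto
  }
  where
  open import Data.List.Sort (Fin.≤-decTotalOrder n) using (sort; sort-↭; sort-↗)
  open PermutationSetoid (setoid (Fin n)) using (Unique-resp-↭)
  L = sort K
  |L|≡|K| : length L ≡ length K
  |L|≡|K| = ↭-length (sort-↭ K)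
  increasing : AllPairs _<_ L
  increasing = AllPairs.zipWith (λ (≤ , ≢) → Fin.≤∧≢⇒< ≤ ≢)
    (Linked⇒AllPairs Fin.≤-trans (sort-↗ K) , Unique-resp-↭ (↭⇒↭ₛ (↭-sym (sort-↭ K))) distinct)
  vertex : Fin (length K) → Fin n
  vertex i = lookup L (cast (sym |L|≡|K|) i)
  cast-strict : ∀ {i j} → i < j → cast (sym |L|≡|K|) i < cast (sym |L|≡|K|) j
  cast-strict {i} {j} = subst₂ ℕ._<_ (sym (Fin.toℕ-cast _ i)) (sym (Fin.toℕ-cast _ j))
  onto : ∀ {x} → x ∈ K → ∃ λ i → x ≡ vertex i
  onto x∈K = cast |L|≡|K| (index x∈L) ,
    trans (lookup-index x∈L) (cong (lookup L) (sym (Fin.cast-involutive (sym |L|≡|K|) |L|≡|K| (index x∈L))))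
    where x∈L = ∈-resp-↭ (↭-sym (sort-↭ K)) x∈K

-- Sums over the copies of K₄ through an edge

K4Condition : Graph n → Fin n → Fin n → Fin n → Fin n → Fin n → Fin n → Bool
K4Condition G u v a b c d = ⌊ a <? b ⌋ ∧ ⌊ b <? c ⌋ ∧ ⌊ c <? d ⌋ ∧ isClique G (a ∷ b ∷ c ∷ d ∷ [])
                            ∧ elem u (a ∷ b ∷ c ∷ d ∷ []) ∧ elem v (a ∷ b ∷ c ∷ d ∷ [])

K4Term : Graph n → Fin n → Fin n → (List (Fin n) → ℚ) → Fin n → Fin n → Fin n → Fin n → ℚ
K4Term G u v F a b c d = when (K4Condition G u v a b c d) (F (a ∷ b ∷ c ∷ d ∷ []))

sumK4∋ : Graph n → Fin n → Fin n → (List (Fin n) → ℚ) → ℚ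
sumK4∋ G u v F = Σv⁴ (K4Term G u v F)

K4Term-≡0 : (G : Graph n) (u v : Fin n) (F : List (Fin n) → ℚ) → ∀ a b c d →
  (elem u (a ∷ b ∷ c ∷ d ∷ []) ≡ true → elem v (a ∷ b ∷ c ∷ d ∷ []) ≡ true → F (a ∷ b ∷ c ∷ d ∷ []) ≡ 0ℚ) →
  K4Term G u v F a b c d ≡ 0ℚ
K4Term-≡0 G u v F a b c d F≡0
  with ⌊ a <? b ⌋ | ⌊ b <? c ⌋ | ⌊ c <? d ⌋ | isClique G (a ∷ b ∷ c ∷ d ∷ [])
     | elem u (a ∷ b ∷ c ∷ d ∷ []) | elem v (a ∷ b ∷ c ∷ d ∷ [])
... | true  | true  | true  | true  | true  | true  = F≡0 refl refl
... | false | _     | _     | _     | _     | _     = refl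
... | true  | false | _     | _     | _     | _     = refl
... | true  | true  | false | _     | _     | _     = refl
... | true  | true  | true  | false | _     | _     = refl
... | true  | true  | true  | true  | false | _     = refl
... | true  | true  | true  | true  | true  | false = refl

module _ (G : Graph n) (u v : Fin n) where

  sumK4∋-* : (c : ℚ) (F : List (Fin n) → ℚ) → sumK4∋ G u v (λ T → c * F T) ≡ c * sumK4∋ G u v F
  sumK4∋-* c F = trans (Σv⁴-cong λ a b c′ d → when-* (K4Condition G u v a b c′ d) c (F (a ∷ b ∷ c′ ∷ d ∷ [])))
                       (sym (*-distribˡ-Σv⁴ c (K4Term G u v F)))

  sumK4∋-0 : sumK4∋ G u v (λ _ → 0ℚ) ≡ 0ℚ
  sumK4∋-0 = Σv⁴-zero λ a b c d → K4Term-≡0 G u v (λ _ → 0ℚ) a b c d λ _ _ → refl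

  sumK4∋-Σv : (F : Fin n → List (Fin n) → ℚ) →
    sumK4∋ G u v (λ T → Σv λ x → F x T) ≡ Σv (λ x → sumK4∋ G u v (F x))
  sumK4∋-Σv F =
    trans (Σv⁴-cong λ a b c d → sym (Σv-when (K4Condition G u v a b c d) (λ x → F x (a ∷ b ∷ c ∷ d ∷ []))))
          (Σv⁴-Σv-comm λ x → K4Term G u v (F x))

  sumK4∋-Σv⁶ : (F : Fin n → Fin n → Fin n → Fin n → Fin n → Fin n → List (Fin n) → ℚ) →
    sumK4∋ G u v (λ T → Σv⁶ λ v₁ v₂ v₃ v₄ v₅ v₆ → F v₁ v₂ v₃ v₄ v₅ v₆ T)
    ≡ Σv⁶ (λ v₁ v₂ v₃ v₄ v₅ v₆ → sumK4∋ G u v (F v₁ v₂ v₃ v₄ v₅ v₆))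
  sumK4∋-Σv⁶ F =
    trans (sumK4∋-Σv λ v₁ T → Σv λ v₂ → Σv λ v₃ → Σv λ v₄ → Σv λ v₅ → Σv λ v₆ → F v₁ v₂ v₃ v₄ v₅ v₆ T)
    (Σv-cong λ v₁ → trans (sumK4∋-Σv λ v₂ T → Σv λ v₃ → Σv λ v₄ → Σv λ v₅ → Σv λ v₆ → F v₁ v₂ v₃ v₄ v₅ v₆ T)
    (Σv-cong λ v₂ → trans (sumK4∋-Σv λ v₃ T → Σv λ v₄ → Σv λ v₅ → Σv λ v₆ → F v₁ v₂ v₃ v₄ v₅ v₆ T)
    (Σv-cong λ v₃ → trans (sumK4∋-Σv λ v₄ T → Σv λ v₅ → Σv λ v₆ → F v₁ v₂ v₃ v₄ v₅ v₆ T)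
    (Σv-cong λ v₄ → trans (sumK4∋-Σv λ v₅ T → Σv λ v₆ → F v₁ v₂ v₃ v₄ v₅ v₆ T)
    (Σv-cong λ v₅ → sumK4∋-Σv (F v₁ v₂ v₃ v₄ v₅))))))

module _ {w : Fin m → Fin n} (≟-preserved : ∀ i j → ⌊ w i ≟ w j ⌋ ≡ ⌊ i ≟ j ⌋) where

  elem-map : ∀ x xs → elem (w x) (map w xs) ≡ elem x xs
  elem-map x = any-map (≟-preserved x)

  countIn-map : ∀ xs ys → countIn (map w xs) (map w ys) ≡ countIn xs ys
  countIn-map []       ys = refl
  countIn-map (x ∷ xs) ys rewrite elem-map x ys with elem x ys
  ... | true  = cong ℕ.suc (countIn-map xs ys)
  ... | false = countIn-map xs ys

isClique-map : {G : Graph n} {H : Graph m} {w : Fin m → Fin n} →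
  (∀ i j → adj G (w i) (w j) ≡ adj H i j) → ∀ xs → isClique G (map w xs) ≡ isClique H xs
isClique-map adj-preserved []       = refl
isClique-map adj-preserved (x ∷ xs) = cong₂ _∧_ (all-map (adj-preserved x) xs) (isClique-map adj-preserved xs)

ψ-cong : {K T : List (Fin n)} {K′ T′ : List (Fin m)} {x y : Fin n} {x′ y′ : Fin m} →
  all (λ t → elem t K) T ≡ all (λ t → elem t K′) T′ →
  countIn (x ∷ y ∷ []) T ≡ countIn (x′ ∷ y′ ∷ []) T′ →
  ψ K x y T ≡ ψ K′ x′ y′ T′
ψ-cong {K′ = K′} {T′} {x′ = x′} {y′} same-⊆ same-count rewrite same-⊆ | same-count
  with all (λ t → elem t K′) T′ | countIn (x′ ∷ y′ ∷ []) T′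
... | false | _                       = refl
... | true  | 0                       = refl
... | true  | 1                       = refl
... | true  | 2                       = refl
... | true  | ℕ.suc (ℕ.suc (ℕ.suc _)) = refl

ψ-outside : {K T : List (Fin n)} {t : Fin n} → t ∈ T → elem t K ≡ false → ∀ x y → ψ K x y T ≡ 0ℚ
ψ-outside {K = K} t∈T t∉K x y rewrite all-false {p = λ t → elem t K} t∈T t∉K = refl

module _ (G : Graph n) (K : List (Fin n)) (u v : Fin n) where

  sumK4∋-ψ-absentˡ : elem u K ≡ false → ∀ x y → sumK4∋ G u v (ψ K x y) ≡ 0ℚ
  sumK4∋-ψ-absentˡ u∉K x y = Σv⁴-zero λ a b c d → K4Term-≡0 G u v (ψ K x y) a b c d
    λ u∈T _ → ψ-outside {K = K} {t = u} (elem⇒∈ {xs = a ∷ b ∷ c ∷ d ∷ []} u∈T) u∉K x y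

  sumK4∋-ψ-absentʳ : elem v K ≡ false → ∀ x y → sumK4∋ G u v (ψ K x y) ≡ 0ℚ
  sumK4∋-ψ-absentʳ v∉K x y = Σv⁴-zero λ a b c d → K4Term-≡0 G u v (ψ K x y) a b c d
    λ _ v∈T → ψ-outside {K = K} {t = v} (elem⇒∈ {xs = a ∷ b ∷ c ∷ d ∷ []} v∈T) v∉K x y

K4Term-map : {G : Graph n} {H : Graph m} {w : Fin m → Fin n} →
  (∀ i j → ⌊ w i <? w j ⌋ ≡ ⌊ i <? j ⌋) → (∀ i j → ⌊ w i ≟ w j ⌋ ≡ ⌊ i ≟ j ⌋) →
  (∀ i j → adj G (w i) (w j) ≡ adj H i j) →
  ∀ u v {F F′} → (∀ T → F (map w T) ≡ F′ T) → ∀ a b c d →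
  K4Term G (w u) (w v) F (w a) (w b) (w c) (w d) ≡ K4Term H u v F′ a b c d
K4Term-map {G = G} {H} {w} <?-preserved ≟-preserved adj-preserved u v F≗F′ a b c d =
  cong₂ when
    (cong₂ _∧_ (<?-preserved a b) (cong₂ _∧_ (<?-preserved b c) (cong₂ _∧_ (<?-preserved c d)
      (cong₂ _∧_ (isClique-map {G = G} {H} {w} adj-preserved abcd)
                 (cong₂ _∧_ (elem-map ≟-preserved u abcd) (elem-map ≟-preserved v abcd))))))
    (F≗F′ abcd)
  where abcd = a ∷ b ∷ c ∷ d ∷ []

-- The edge-gadget property

≟-sym : (i j : Fin n) → ⌊ i ≟ j ⌋ ≡ ⌊ j ≟ i ⌋
≟-sym i j with i ≟ j
... | yes i≡j = sym (⌊⌋-yes (j ≟ i) (sym i≡j))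
... | no  i≢j = sym (⌊⌋-no (j ≟ i) (i≢j ∘ sym))

complete : (m : ℕ) → Graph m
complete m = record
  { adj    = λ i j → not ⌊ i ≟ j ⌋
  ; sym    = λ i j → cong not (≟-sym i j)
  ; irrefl = λ i → cong not (⌊⌋-yes (i ≟ i) refl)
  }

δ² : Fin n → Fin n → Fin n → Fin n → ℚ
δ² a b x y = when (⌊ a ≟ x ⌋ ∧ ⌊ b ≟ y ⌋) 1ℚ

δ²-≢ˡ : {a b x y : Fin n} → x ≢ a → δ² a b x y ≡ 0ℚ
δ²-≢ˡ {a = a} {x = x} x≢a rewrite ⌊⌋-no (a ≟ x) (x≢a ∘ sym) = refl

δ²-≢ʳ : {a b x y : Fin n} → y ≢ b → δ² a b x y ≡ 0ℚ
δ²-≢ʳ {a = a} {b} {x} {y} y≢b rewrite ⌊⌋-no (b ≟ y) (y≢b ∘ sym) | Bool.∧-zeroʳ ⌊ a ≟ x ⌋ = refl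

δ²-diag : (a b : Fin n) → δ² a b a b ≡ 1ℚ
δ²-diag a b rewrite ⌊⌋-yes (a ≟ a) refl | ⌊⌋-yes (b ≟ b) refl = refl

sameEdge : Fin n → Fin n → Fin n → Fin n → ℚ
sameEdge u v x y = δ² u v x y + δ² v u x y

sameEdge-comm : (u v x y : Fin n) → sameEdge u v x y ≡ sameEdge v u x y
sameEdge-comm u v x y = ℚ.+-comm (δ² u v x y) (δ² v u x y)

sameEdge-absent : (u v x y : Fin n) → x ≢ u → y ≢ u → sameEdge u v x y ≡ 0ℚ
sameEdge-absent u v x y x≢u y≢u = cong₂ _+_ (δ²-≢ˡ {b = v} {y = y} x≢u) (δ²-≢ʳ {a = v} {x = x} y≢u)

sameEdge-map : {w : Fin m → Fin n} → (∀ i j → ⌊ w i ≟ w j ⌋ ≡ ⌊ i ≟ j ⌋) →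
  ∀ u v x y → sameEdge (w u) (w v) (w x) (w y) ≡ sameEdge u v x y
sameEdge-map ≟-preserved u v x y
  rewrite ≟-preserved u x | ≟-preserved v y | ≟-preserved v x | ≟-preserved u y = refl

-- Checked by evaluation for all u, v, x, y; restricting to increasing quadruples first keeps
-- the evaluation small.
edgeGadget-complete₆ : (u v x y : Fin 6) → u ≢ v → x ≢ y →
  sumK4∋ (complete 6) u v (ψ (allFin 6) x y) ≡ sameEdge u v x y
edgeGadget-complete₆ u v x y u≢v x≢y =
  trans (Σv⁴-when-ordered (counted u v) (λ a b c d → ψ (allFin 6) x y (quad a b c d))) (checked u v x y u≢v x≢y)
  where
  quad : Fin 6 → Fin 6 → Fin 6 → Fin 6 → List (Fin 6)
  quad a b c d = a ∷ b ∷ c ∷ d ∷ []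
  counted : (u v a b c d : Fin 6) → Bool
  counted u v a b c d = isClique (complete 6) (quad a b c d) ∧ elem u (quad a b c d) ∧ elem v (quad a b c d)
  increasingSum : (u v x y : Fin 6) → ℚ
  increasingSum u v x y = Σ-increasing⁴ λ a b c d → when (counted u v a b c d) (ψ (allFin 6) x y (quad a b c d))
  checked : ∀ u v x y → u ≢ v → x ≢ y → increasingSum u v x y ≡ sameEdge u v x y
  checked = toWitness {a? = all? λ u → all? λ v → all? λ x → all? λ y →
    ¬? (u ≟ v) →-dec ¬? (x ≟ y) →-dec increasingSum u v x y ℚ.≟ sameEdge u v x y} _

module CliqueEnumeration (G : Graph n) (K : List (Fin n)) (clique : isClique G K ≡ true) where

  open IncreasingEnumeration
    (sortedEnumeration K (AllPairs.map (adjacent⇒≢ G) (isClique⇒AllPairs G clique))) public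
  open StrictlyMonotone strict public

  adj-preserved : ∀ i j → adj G (vertex i) (vertex j) ≡ adj (complete (length K)) i j
  adj-preserved i j with i ≟ j
  ... | yes refl = irrefl G (vertex i)
  ... | no  i≢j  = AllPairs-∈ (λ {x} {y} → trans (Graph.sym G y x)) (isClique⇒AllPairs G clique)
                     (inside i) (inside j) (i≢j ∘ injective)

  sumK4∋-ψ-vertex : ∀ u v x y →
    sumK4∋ G (vertex u) (vertex v) (ψ K (vertex x) (vertex y))
    ≡ sumK4∋ (complete (length K)) u v (ψ (allFin (length K)) x y)
  sumK4∋-ψ-vertex u v x y =
    trans (Σv⁴-reindex injective (K4Term G (vertex u) (vertex v) (ψ K (vertex x) (vertex y))) vanish)
          (Σv⁴-cong (K4Term-map {G = G} {complete (length K)} <?-preserved ≟-preserved adj-preserved u v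
            {F = ψ K (vertex x) (vertex y)} {F′ = ψ (allFin (length K)) x y} ψ-vertex))
    where
    ψ-vertex : ∀ T → ψ K (vertex x) (vertex y) (map vertex T) ≡ ψ (allFin (length K)) x y T
    ψ-vertex T = ψ-cong {K = K} {map vertex T} {allFin (length K)} {T} {vertex x} {vertex y} {x} {y}
      (all-map (λ t → trans (∈⇒elem (inside t)) (sym (∈⇒elem (∈-allFin t)))) T)
      (countIn-map ≟-preserved (x ∷ y ∷ []) T)
    vanish : ∀ a b c d {t} → t ∈ a ∷ b ∷ c ∷ d ∷ [] → (∀ i → t ≢ vertex i) →
      K4Term G (vertex u) (vertex v) (ψ K (vertex x) (vertex y)) a b c d ≡ 0ℚ
    vanish a b c d {t} t∈T t∉vertex =
      K4Term-≡0 G (vertex u) (vertex v) (ψ K (vertex x) (vertex y)) a b c d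
        (λ _ _ → ψ-outside {K = K} t∈T t∉K (vertex x) (vertex y))
      where
      t∉K : elem t K ≡ false
      t∉K with elem t K in t∈K
      ... | false = refl
      ... | true  = let i , t≡vertex-i = onto (elem⇒∈ t∈K) in ⊥-elim (t∉vertex i t≡vertex-i)

module _ (G : Graph n) (v₁ v₂ v₃ v₄ v₅ v₆ : Fin n)
         (clique : isClique G (v₁ ∷ v₂ ∷ v₃ ∷ v₄ ∷ v₅ ∷ v₆ ∷ []) ≡ true) where

  private
    K : List (Fin n)
    K = v₁ ∷ v₂ ∷ v₃ ∷ v₄ ∷ v₅ ∷ v₆ ∷ []

  open CliqueEnumeration G K clique

  edgeGadget : ∀ {u v} → u ≢ v → sumK4∋ G u v (ψ K v₁ v₂) ≡ sameEdge u v v₁ v₂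
  edgeGadget {u} {v} u≢v with elem u K in u∈K | elem v K in v∈K
  ... | false | _ = begin
      sumK4∋ G u v (ψ K v₁ v₂)  ≡⟨ sumK4∋-ψ-absentˡ G K u v u∈K v₁ v₂ ⟩
      0ℚ                        ≡⟨ sameEdge-absent u v v₁ v₂ (absent⇒≢ {K = K} u∈K (here refl))
                                                             (absent⇒≢ {K = K} u∈K (there (here refl))) ⟨
      sameEdge u v v₁ v₂        ∎
    where open ≡-Reasoning
  ... | true | false = begin
      sumK4∋ G u v (ψ K v₁ v₂)  ≡⟨ sumK4∋-ψ-absentʳ G K u v v∈K v₁ v₂ ⟩
      0ℚ                        ≡⟨ sameEdge-absent v u v₁ v₂ (absent⇒≢ {K = K} v∈K (here refl))
                                                             (absent⇒≢ {K = K} v∈K (there (here refl))) ⟨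
      sameEdge v u v₁ v₂        ≡⟨ sameEdge-comm v u v₁ v₂ ⟩
      sameEdge u v v₁ v₂        ∎
    where open ≡-Reasoning
  ... | true | true
    with onto (elem⇒∈ {x = u} u∈K) | onto (elem⇒∈ {x = v} v∈K)
       | onto {v₁} (here refl)      | onto {v₂} (there (here refl))
  ...   | pu , refl | pv , refl | p₁ , v₁≡ | p₂ , v₂≡ = begin
      sumK4∋ G (vertex pu) (vertex pv) (ψ K v₁ v₂)
    ≡⟨ cong₂ (λ x y → sumK4∋ G (vertex pu) (vertex pv) (ψ K x y)) v₁≡ v₂≡ ⟩
      sumK4∋ G (vertex pu) (vertex pv) (ψ K (vertex p₁) (vertex p₂))
    ≡⟨ sumK4∋-ψ-vertex pu pv p₁ p₂ ⟩
      sumK4∋ (complete 6) pu pv (ψ (allFin 6) p₁ p₂)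
    ≡⟨ edgeGadget-complete₆ pu pv p₁ p₂ (u≢v ∘ cong vertex)
         (v₁≢v₂ ∘ λ p₁≡p₂ → trans v₁≡ (trans (cong vertex p₁≡p₂) (sym v₂≡))) ⟩
      sameEdge pu pv p₁ p₂
    ≡⟨ sameEdge-map ≟-preserved pu pv p₁ p₂ ⟨
      sameEdge (vertex pu) (vertex pv) (vertex p₁) (vertex p₂)
    ≡⟨ cong₂ (sameEdge (vertex pu) (vertex pv)) v₁≡ v₂≡ ⟨
      sameEdge (vertex pu) (vertex pv) v₁ v₂
    ∎
    where
    open ≡-Reasoning
    v₁≢v₂ : v₁ ≢ v₂
    v₁≢v₂ with (v₁v₂ ∷ _) ∷ _ ← isClique⇒AllPairs G {K} clique = adjacent⇒≢ G v₁v₂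

-- Telescoping the clique weights

length-filterᵇ-∧ : (p q : A → Bool) (xs : List A) →
  length (filterᵇ p xs) ℕ.+ length (filterᵇ q xs) ℕ.≤ length (filterᵇ (λ x → p x ∧ q x) xs) ℕ.+ length xs
length-filterᵇ-∧ p q [] = z≤n
length-filterᵇ-∧ p q (x ∷ xs) with p x | q x | length-filterᵇ-∧ p q xs
... | true  | true  | ih rewrite ℕ.+-suc (length (filterᵇ p xs)) (length (filterᵇ q xs))
                              | ℕ.+-suc (length (filterᵇ (λ x → p x ∧ q x) xs)) (length xs) = s≤s (s≤s ih)
... | true  | false | ih rewrite ℕ.+-suc (length (filterᵇ (λ x → p x ∧ q x) xs)) (length xs) = s≤s ih
... | false | true  | ih rewrite ℕ.+-suc (length (filterᵇ p xs)) (length (filterᵇ q xs))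
                              | ℕ.+-suc (length (filterᵇ (λ x → p x ∧ q x) xs)) (length xs) = s≤s ih
... | false | false | ih rewrite ℕ.+-suc (length (filterᵇ (λ x → p x ∧ q x) xs)) (length xs) = ℕ.m≤n⇒m≤1+n ih

length-filterᵇ-true : (xs : List A) → length (filterᵇ (λ _ → true) xs) ≡ length xs
length-filterᵇ-true []       = refl
length-filterᵇ-true (x ∷ xs) = cong ℕ.suc (length-filterᵇ-true xs)

module _ (G : Graph n) where
  commonNbr-[] : commonNbr G [] ≡ n
  commonNbr-[] = trans (length-filterᵇ-true (allFin n)) (length-tabulate id)

  commonNbr-∷ : ∀ s S → deg G s ℕ.+ commonNbr G S ℕ.≤ commonNbr G (s ∷ S) ℕ.+ n
  commonNbr-∷ s S = subst (λ k → deg G s ℕ.+ commonNbr G S ℕ.≤ commonNbr G (s ∷ S) ℕ.+ k) (length-tabulate id)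
    (length-filterᵇ-∧ (adj G s) (λ w → all (λ s′ → adj G s′ w) S) (allFin n))

  module _ (δ>4n/5 : minDegGT45 G) where

    -- 5 |N(S)| ≥ 5n - |S| (n - 1), arranged to avoid truncated subtraction.
    commonNbr-bound : ∀ S → 5 ℕ.* n ℕ.+ length S ℕ.≤ 5 ℕ.* commonNbr G S ℕ.+ length S ℕ.* n
    commonNbr-bound [] = ℕ.≤-reflexive (cong (λ k → 5 ℕ.* k ℕ.+ 0) (sym commonNbr-[]))
    commonNbr-bound (s ∷ S) = ℕ.+-cancelˡ-≤ (4 ℕ.* n) _ _ (begin
        4 ℕ.* n ℕ.+ (5 ℕ.* n ℕ.+ ℕ.suc k)
      ≡⟨ shift n k ⟩
        ℕ.suc (4 ℕ.* n) ℕ.+ (5 ℕ.* n ℕ.+ k)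
      ≤⟨ ℕ.+-mono-≤ (δ>4n/5 s) (commonNbr-bound S) ⟩
        5 ℕ.* deg G s ℕ.+ (5 ℕ.* commonNbr G S ℕ.+ k ℕ.* n)
      ≡⟨ collect (deg G s) (commonNbr G S) k n ⟩
        5 ℕ.* (deg G s ℕ.+ commonNbr G S) ℕ.+ k ℕ.* n
      ≤⟨ ℕ.+-monoˡ-≤ (k ℕ.* n) (ℕ.*-monoʳ-≤ 5 (commonNbr-∷ s S)) ⟩
        5 ℕ.* (commonNbr G (s ∷ S) ℕ.+ n) ℕ.+ k ℕ.* n
      ≡⟨ expand (commonNbr G (s ∷ S)) n k ⟩
        4 ℕ.* n ℕ.+ (5 ℕ.* commonNbr G (s ∷ S) ℕ.+ (n ℕ.+ k ℕ.* n))
      ∎)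
      where
      open ℕ.≤-Reasoning
      k = length S
      shift : ∀ n k → 4 ℕ.* n ℕ.+ (5 ℕ.* n ℕ.+ ℕ.suc k) ≡ ℕ.suc (4 ℕ.* n) ℕ.+ (5 ℕ.* n ℕ.+ k)
      shift = ℕ-Solver.solve-∀
      collect : ∀ d c k n → 5 ℕ.* d ℕ.+ (5 ℕ.* c ℕ.+ k ℕ.* n) ≡ 5 ℕ.* (d ℕ.+ c) ℕ.+ k ℕ.* n
      collect = ℕ-Solver.solve-∀
      expand : ∀ c n k → 5 ℕ.* (c ℕ.+ n) ℕ.+ k ℕ.* n ≡ 4 ℕ.* n ℕ.+ (5 ℕ.* c ℕ.+ (n ℕ.+ k ℕ.* n))
      expand = ℕ-Solver.solve-∀

    commonNbr-positive : ∀ S → 1 ℕ.≤ length S → length S ℕ.≤ 5 → 0 ℕ.< commonNbr G S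
    commonNbr-positive S 1≤k k≤5 with commonNbr G S | commonNbr-bound S
    ... | ℕ.suc _ | _     = s≤s z≤n
    ... | ℕ.zero  | bound = ⊥-elim (ℕ.<-irrefl refl (ℕ.<-≤-trans 1≤k (ℕ.+-cancelˡ-≤ (5 ℕ.* n) _ _ (begin
        5 ℕ.* n ℕ.+ length S  ≤⟨ bound ⟩
        length S ℕ.* n        ≤⟨ ℕ.*-monoˡ-≤ n k≤5 ⟩
        5 ℕ.* n               ≡⟨ ℕ.+-identityʳ (5 ℕ.* n) ⟨
        5 ℕ.* n ℕ.+ 0         ∎))))
      where open ℕ.≤-Reasoning

fromℕ : ℕ → ℚ
fromℕ k = mkℚ (ℤ.+ k) 0 (coprime-sym (1-coprimeTo k))

fromℕ-suc : ∀ k → 1ℚ + fromℕ k ≡ fromℕ (ℕ.suc k)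
fromℕ-suc k = ℚ.toℚᵘ-injective (ℚᵘ.≃-trans (ℚ.toℚᵘ-homo-+ 1ℚ (fromℕ k)) (ℚᵘ.*≡* (numerators (ℤ.+ k))))
  where
  numerators : ∀ i → (ℤ.1ℤ ℤ.* ℤ.1ℤ ℤ.+ i ℤ.* ℤ.1ℤ) ℤ.* ℤ.1ℤ ≡ (ℤ.1ℤ ℤ.+ i) ℤ.* (ℤ.1ℤ ℤ.* ℤ.1ℤ)
  numerators = ℤ-Solver.solve-∀

×1≡fromℕ : ∀ k → k × 1ℚ ≡ fromℕ k
×1≡fromℕ ℕ.zero    = refl
×1≡fromℕ (ℕ.suc k) = trans (cong (1ℚ +_) (×1≡fromℕ k)) (fromℕ-suc k)

×-inv : ∀ k → ℕ.suc k × inv (ℕ.suc k) ≡ 1ℚ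
×-inv k = begin
  ℕ.suc k × inv (ℕ.suc k)               ≡⟨ cong (ℕ.suc k ×_) (ℚ.*-identityˡ (inv (ℕ.suc k))) ⟨
  ℕ.suc k × (1ℚ * inv (ℕ.suc k))        ≡⟨ ×-assoc-* (ℕ.suc k) 1ℚ (inv (ℕ.suc k)) ⟨
  (ℕ.suc k × 1ℚ) * inv (ℕ.suc k)        ≡⟨ cong₂ _*_ (×1≡fromℕ (ℕ.suc k))
                                                     (ℚ.normalize-coprime (1-coprimeTo (ℕ.suc k))) ⟩
  fromℕ (ℕ.suc k) * 1/ fromℕ (ℕ.suc k)  ≡⟨ ℚ.*-inverseʳ (fromℕ (ℕ.suc k)) ⟩
  1ℚ                                    ∎
  where open ≡-Reasoning

ΣL-const-inv : (xs : List A) → 0 ℕ.< length xs → (c : ℚ) → ΣL xs (λ _ → c * inv (length xs)) ≡ c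
ΣL-const-inv xs@(_ ∷ ys) _ c = begin
  ΣL xs (λ _ → c * inv (length xs))   ≡⟨ ΣL-const xs (c * inv (length xs)) ⟩
  length xs × (c * inv (length xs))   ≡⟨ ×-comm-* (length xs) c (inv (length xs)) ⟨
  c * (length xs × inv (length xs))   ≡⟨ cong (c *_) (×-inv (length ys)) ⟩
  c * 1ℚ                              ≡⟨ ℚ.*-identityʳ c ⟩
  c                                   ∎
  where open ≡-Reasoning

Σv-extendClique : (G : Graph n) (S : List (Fin n)) → 0 ℕ.< commonNbr G S → (c : ℚ) →
  Σv (λ z → when (isClique G (S ++ z ∷ [])) (c * inv (commonNbr G S))) ≡ when (isClique G S) c
Σv-extendClique {n} G S N>0 c = begin
    Σv (λ z → when (isClique G (S ++ z ∷ [])) (c * inv N))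
  ≡⟨ Σv-cong (λ z → trans (cong (λ b → when b (c * inv N)) (isClique-snoc G S z))
                          (when-∧ (isClique G S) (neighbourOfAll z) (c * inv N))) ⟩
    Σv (λ z → when (isClique G S) (when (neighbourOfAll z) (c * inv N)))
  ≡⟨ Σv-when (isClique G S) (λ z → when (neighbourOfAll z) (c * inv N)) ⟩
    when (isClique G S) (Σv λ z → when (neighbourOfAll z) (c * inv N))
  ≡⟨ cong (when (isClique G S)) (ΣL-filterᵇ (allFin n) neighbourOfAll (λ b _ → when b (c * inv N)) (λ _ → refl)) ⟩
    when (isClique G S) (ΣL (filterᵇ neighbourOfAll (allFin n)) (λ _ → c * inv N))
  ≡⟨ cong (when (isClique G S)) (ΣL-const-inv (filterᵇ neighbourOfAll (allFin n)) N>0 c) ⟩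
    when (isClique G S) c
  ∎
  where
  open ≡-Reasoning
  neighbourOfAll : Fin n → Bool
  neighbourOfAll z = all (λ s → adj G s z) S
  N = commonNbr G S

cliqueWeight : Graph n → Fin n → Fin n → ℚ
cliqueWeight G x y = Σv⁴ λ a b c d → when (isClique G (x ∷ y ∷ a ∷ b ∷ c ∷ d ∷ [])) (W5 G x y a b c)

cliqueWeight≡1 : (G : Graph n) → minDegGT45 G → ∀ x y → adj G x y ≡ true → cliqueWeight G x y ≡ 1ℚ
cliqueWeight≡1 {n} G δ>4n/5 x y xy = begin
    Σv⁴ (λ a b c d → when (isClique G (x ∷ y ∷ a ∷ b ∷ c ∷ d ∷ [])) (N₂ * (N₃ a * (N₄ a b * N₅ a b c))))
  ≡⟨ Σv⁴-cong (λ a b c d → cong (when (isClique G (x ∷ y ∷ a ∷ b ∷ c ∷ d ∷ [])))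
                                (reassoc N₂ (N₃ a) (N₄ a b) (N₅ a b c))) ⟩
    Σv⁴ (λ a b c d → when (isClique G (x ∷ y ∷ a ∷ b ∷ c ∷ d ∷ [])) (((N₂ * N₃ a) * N₄ a b) * N₅ a b c))
  ≡⟨ Σv-cong (λ a → Σv-cong λ b → Σv-cong λ c →
       Σv-extendClique G (x ∷ y ∷ a ∷ b ∷ c ∷ []) (positive (x ∷ y ∷ a ∷ b ∷ c ∷ [])) ((N₂ * N₃ a) * N₄ a b)) ⟩
    Σv (λ a → Σv λ b → Σv λ c → when (isClique G (x ∷ y ∷ a ∷ b ∷ c ∷ [])) ((N₂ * N₃ a) * N₄ a b))
  ≡⟨ Σv-cong (λ a → Σv-cong λ b →
       Σv-extendClique G (x ∷ y ∷ a ∷ b ∷ []) (positive (x ∷ y ∷ a ∷ b ∷ [])) (N₂ * N₃ a)) ⟩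
    Σv (λ a → Σv λ b → when (isClique G (x ∷ y ∷ a ∷ b ∷ [])) (N₂ * N₃ a))
  ≡⟨ Σv-cong (λ a → Σv-extendClique G (x ∷ y ∷ a ∷ []) (positive (x ∷ y ∷ a ∷ [])) N₂) ⟩
    Σv (λ a → when (isClique G (x ∷ y ∷ a ∷ [])) N₂)
  ≡⟨ Σv-cong (λ a → cong (when (isClique G (x ∷ y ∷ a ∷ []))) (ℚ.*-identityˡ N₂)) ⟨
    Σv (λ a → when (isClique G (x ∷ y ∷ a ∷ [])) (1ℚ * N₂))
  ≡⟨ Σv-extendClique G (x ∷ y ∷ []) (positive (x ∷ y ∷ [])) 1ℚ ⟩
    when (isClique G (x ∷ y ∷ [])) 1ℚ
  ≡⟨ cong (λ b → when ((b ∧ true) ∧ true) 1ℚ) xy ⟩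
    1ℚ
  ∎
  where
  open ≡-Reasoning
  N₂ = inv (commonNbr G (x ∷ y ∷ []))
  N₃ = λ a → inv (commonNbr G (x ∷ y ∷ a ∷ []))
  N₄ = λ a b → inv (commonNbr G (x ∷ y ∷ a ∷ b ∷ []))
  N₅ = λ a b c → inv (commonNbr G (x ∷ y ∷ a ∷ b ∷ c ∷ []))
  reassoc : ∀ p q r s → p * (q * (r * s)) ≡ ((p * q) * r) * s
  reassoc p q r s = begin
    p * (q * (r * s))  ≡⟨ cong (p *_) (ℚ.*-assoc q r s) ⟨
    p * ((q * r) * s)  ≡⟨ ℚ.*-assoc p (q * r) s ⟨
    (p * (q * r)) * s  ≡⟨ cong (_* s) (ℚ.*-assoc p q r) ⟨
    ((p * q) * r) * s  ∎
  positive : ∀ S {1≤|S| : T (1 ℕ.≤ᵇ length S)} {|S|≤5 : T (length S ℕ.≤ᵇ 5)} → 0 ℕ.< commonNbr G S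
  positive S {1≤|S|} {|S|≤5} =
    commonNbr-positive G δ>4n/5 S (ℕ.≤ᵇ⇒≤ 1 (length S) 1≤|S|) (ℕ.≤ᵇ⇒≤ (length S) 5 |S|≤5)

Σv²-sameEdge : (u v : Fin n) (Ω : Fin n → Fin n → ℚ) →
  Σv (λ x → Σv λ y → sameEdge u v x y * Ω x y) ≡ Ω u v + Ω v u
Σv²-sameEdge {n} u v Ω = begin
    Σv (λ x → Σv λ y → sameEdge u v x y * Ω x y)
  ≡⟨ Σv-cong (λ x → trans (Σv-cong λ y → ℚ.*-distribʳ-+ (Ω x y) (δ² u v x y) (δ² v u x y))
                          (Σv-distrib-+ (λ y → δ² u v x y * Ω x y) (λ y → δ² v u x y * Ω x y))) ⟩
    Σv (λ x → Σv (λ y → δ² u v x y * Ω x y) + Σv (λ y → δ² v u x y * Ω x y))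
  ≡⟨ Σv-distrib-+ (λ x → Σv λ y → δ² u v x y * Ω x y) (λ x → Σv λ y → δ² v u x y * Ω x y) ⟩
    Σv (λ x → Σv λ y → δ² u v x y * Ω x y) + Σv (λ x → Σv λ y → δ² v u x y * Ω x y)
  ≡⟨ cong₂ _+_ (Σv²-δ² u v) (Σv²-δ² v u) ⟩
    Ω u v + Ω v u
  ∎
  where
  open ≡-Reasoning
  Σv²-δ² : ∀ a b → Σv (λ x → Σv λ y → δ² a b x y * Ω x y) ≡ Ω a b
  Σv²-δ² a b = begin
      Σv (λ x → Σv λ y → δ² a b x y * Ω x y)
    ≡⟨ Σv-δ _ a (λ x x≢a → Σv-zero {n} λ y →
         trans (cong (_* Ω x y) (δ²-≢ˡ {a = a} {b} {x} {y} x≢a)) (ℚ.*-zeroˡ (Ω x y))) ⟩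
      Σv (λ y → δ² a b a y * Ω a y)
    ≡⟨ Σv-δ _ b (λ y y≢b → trans (cong (_* Ω a y) (δ²-≢ʳ {a = a} {b} {a} y≢b)) (ℚ.*-zeroˡ (Ω a y))) ⟩
      δ² a b a b * Ω a b
    ≡⟨ cong (_* Ω a b) (δ²-diag a b) ⟩
      1ℚ * Ω a b
    ≡⟨ ℚ.*-identityˡ (Ω a b) ⟩
      Ω a b
    ∎

½ : ℚ
½ = ℤ.+ 1 / 2

ψ⁶ : (v₁ v₂ v₃ v₄ v₅ v₆ : Fin n) → List (Fin n) → ℚ
ψ⁶ v₁ v₂ v₃ v₄ v₅ v₆ = ψ (v₁ ∷ v₂ ∷ v₃ ∷ v₄ ∷ v₅ ∷ v₆ ∷ []) v₁ v₂

module _ (G : Graph n) where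

  weighted : (v₁ v₂ v₃ v₄ v₅ v₆ : Fin n) → ℚ → ℚ
  weighted v₁ v₂ v₃ v₄ v₅ v₆ q = when (isClique G (v₁ ∷ v₂ ∷ v₃ ∷ v₄ ∷ v₅ ∷ v₆ ∷ [])) (W5 G v₁ v₂ v₃ v₄ v₅ * q)

  sumK4Containing-exchange : ∀ u v → sumK4Containing G u v
    ≡ ½ * Σv⁶ (λ v₁ v₂ v₃ v₄ v₅ v₆ → sumK4∋ G u v (weighted v₁ v₂ v₃ v₄ v₅ v₆ ∘ ψ⁶ v₁ v₂ v₃ v₄ v₅ v₆))
  sumK4Containing-exchange u v =
    trans (sumK4∋-* G u v ½ (λ T → Σv⁶ λ v₁ v₂ v₃ v₄ v₅ v₆ → term v₁ v₂ v₃ v₄ v₅ v₆ T))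
          (cong (½ *_) (sumK4∋-Σv⁶ G u v term))
    where
    term : (v₁ v₂ v₃ v₄ v₅ v₆ : Fin n) → List (Fin n) → ℚ
    term v₁ v₂ v₃ v₄ v₅ v₆ = weighted v₁ v₂ v₃ v₄ v₅ v₆ ∘ ψ⁶ v₁ v₂ v₃ v₄ v₅ v₆

  sumK4∋-weighted-ψ⁶ : ∀ {u v} → u ≢ v → ∀ v₁ v₂ v₃ v₄ v₅ v₆ →
    sumK4∋ G u v (weighted v₁ v₂ v₃ v₄ v₅ v₆ ∘ ψ⁶ v₁ v₂ v₃ v₄ v₅ v₆)
    ≡ weighted v₁ v₂ v₃ v₄ v₅ v₆ (sameEdge u v v₁ v₂)
  sumK4∋-weighted-ψ⁶ {u} {v} u≢v v₁ v₂ v₃ v₄ v₅ v₆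
    with isClique G (v₁ ∷ v₂ ∷ v₃ ∷ v₄ ∷ v₅ ∷ v₆ ∷ []) in clique
  ... | false = sumK4∋-0 G u v
  ... | true  = trans (sumK4∋-* G u v (W5 G v₁ v₂ v₃ v₄ v₅) (ψ⁶ v₁ v₂ v₃ v₄ v₅ v₆))
                      (cong (W5 G v₁ v₂ v₃ v₄ v₅ *_) (edgeGadget G v₁ v₂ v₃ v₄ v₅ v₆ clique u≢v))

  Σv⁴-weighted : ∀ v₁ v₂ q → Σv⁴ (λ v₃ v₄ v₅ v₆ → weighted v₁ v₂ v₃ v₄ v₅ v₆ q) ≡ q * cliqueWeight G v₁ v₂
  Σv⁴-weighted v₁ v₂ q = trans
    (Σv⁴-cong λ v₃ v₄ v₅ v₆ → trans (cong (when (K₆ v₃ v₄ v₅ v₆)) (ℚ.*-comm (W5 G v₁ v₂ v₃ v₄ v₅) q))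
                                    (when-* (K₆ v₃ v₄ v₅ v₆) q (W5 G v₁ v₂ v₃ v₄ v₅)))
    (sym (*-distribˡ-Σv⁴ q λ v₃ v₄ v₅ v₆ → when (K₆ v₃ v₄ v₅ v₆) (W5 G v₁ v₂ v₃ v₄ v₅)))
    where
    K₆ : Fin n → Fin n → Fin n → Fin n → Bool
    K₆ v₃ v₄ v₅ v₆ = isClique G (v₁ ∷ v₂ ∷ v₃ ∷ v₄ ∷ v₅ ∷ v₆ ∷ [])

theorem2p2 : (n : ℕ) (G : Graph n) → minDegGT45 G →
    (u v : Fin n) → adj G u v ≡ true → sumK4Containing G u v ≡ 1ℚ
theorem2p2 n G δ>4n/5 u v uv = begin
    sumK4Containing G u v
  ≡⟨ sumK4Containing-exchange G u v ⟩
    ½ * Σv⁶ (λ v₁ v₂ v₃ v₄ v₅ v₆ → sumK4∋ G u v (weighted G v₁ v₂ v₃ v₄ v₅ v₆ ∘ ψ⁶ v₁ v₂ v₃ v₄ v₅ v₆))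
  ≡⟨ cong (½ *_) (Σv⁶-cong (sumK4∋-weighted-ψ⁶ G (adjacent⇒≢ G uv))) ⟩
    ½ * Σv⁶ (λ v₁ v₂ v₃ v₄ v₅ v₆ → weighted G v₁ v₂ v₃ v₄ v₅ v₆ (sameEdge u v v₁ v₂))
  ≡⟨ cong (½ *_) (Σv-cong λ v₁ → Σv-cong λ v₂ → Σv⁴-weighted G v₁ v₂ (sameEdge u v v₁ v₂)) ⟩
    ½ * Σv (λ v₁ → Σv λ v₂ → sameEdge u v v₁ v₂ * cliqueWeight G v₁ v₂)
  ≡⟨ cong (½ *_) (Σv²-sameEdge u v (cliqueWeight G)) ⟩
    ½ * (cliqueWeight G u v + cliqueWeight G v u)
  ≡⟨ cong (½ *_) (cong₂ _+_ (cliqueWeight≡1 G δ>4n/5 u v uv)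
                            (cliqueWeight≡1 G δ>4n/5 v u (trans (Graph.sym G v u) uv))) ⟩
    ½ * (1ℚ + 1ℚ)
  ≡⟨⟩
    1ℚ
  ∎
  where open ≡-Reasoning
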